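{- Let $A$ be an incomplete symmetric matrix and let $w(A)$ be the set of distinct numerical values appearing in $A$. Then $A$ has a Robinsonian completion if and only if $A$ has a Robinsonian completion in $w(A)$.
   Context: An $n\times n$ symmetric matrix $A=(a_{i,j})$ with real entries is \emph{incomplete} if some of its entries are missing, written $a_{i,j}=*$ (with $a_{i,j}=a_{j,i}$ and missing entries placed symmetrically). $w(A)$ is the set of distinct real values among the non-missing entries of $A$ (the symbol $*$ is not in $w(A)$). A complete symmetric matrix is \emph{Robinson} if $a_{i,j}\le \min\{a_{i,j-1},a_{i+1,j}\}$ for all $1\le i<j\le n$, and \emph{Robinsonian} if there is a permutation $\pi$ of $\{1,\dots,n\}$ such that the matrix with entries $a_{\pi(i),\pi(j)}$ is Robinson. A \emph{completion} of $A$ is a symmetric assignment of real values to all missing entries; it is \emph{Robinsonian} if the resulting complete matrix is Robinsonian; for $S\subseteq\mathbb{R}$, a \emph{completion in $S$} is one all of whose assigned values lie in $S$. -}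

module Defs where

open import Level using (Level; _⊔_)
open import Data.Nat using (ℕ; suc) renaming (_≤_ to _≤ℕ_)
open import Data.Fin using (Fin; toℕ)
open import Data.Fin.Permutation using (Permutation′; _⟨$⟩ʳ_)
open import Data.Maybe using (Maybe; just; nothing)
open import Data.Product using (_×_; ∃; Σ)
open import Relation.Binary.Bundles using (TotalOrder)
open import Relation.Binary.PropositionalEquality using (_≡_)

-- The entries live in an arbitrary total order (the paper uses ℝ, which is
-- one instance; the stdlib has no reals).  Equality of entries is the
-- order's equivalence _≈_.
module _ {c ℓ₁ ℓ₂ : Level} (O : TotalOrder c ℓ₁ ℓ₂) where
  open TotalOrder O renaming (Carrier to V)

  Matrix : ℕ → Set c
  Matrix n = Fin n → Fin n → V

  -- incomplete n×n matrix: `nothing` is the missing symbol *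
  IMatrix : ℕ → Set c
  IMatrix n = Fin n → Fin n → Maybe V

  Symmetric : {n : ℕ} → Matrix n → Set ℓ₁
  Symmetric {n} B = (i j : Fin n) → B i j ≈ B j i

  ISymmetric : {n : ℕ} → IMatrix n → Set (c ⊔ ℓ₁)
  ISymmetric {n} A =
    (i j : Fin n) →
      (A i j ≡ nothing → A j i ≡ nothing) ×
      ((x : V) → A i j ≡ just x → Σ V λ y → (A j i ≡ just y) × (x ≈ y))

  _∈w_ : {n : ℕ} → V → IMatrix n → Set (c ⊔ ℓ₁)
  _∈w_ {n} v A = Σ (Fin n) λ k → Σ (Fin n) λ l → Σ V λ x → (A k l ≡ just x) × (v ≈ x)

  -- Robinson: for all i < j,  a_{i,j} ≤ a_{i,j-1}  and  a_{i,j} ≤ a_{i+1,j}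
  -- (a ≤ min{b,c} written as a ≤ b and a ≤ c)
  Robinson : {n : ℕ} → Matrix n → Set ℓ₂
  Robinson {n} B =
    ((i j′ j : Fin n) → toℕ j ≡ suc (toℕ j′) → toℕ i ≤ℕ toℕ j′ → B i j ≤ B i j′) ×
    ((i i′ j : Fin n) → toℕ i′ ≡ suc (toℕ i) → toℕ i′ ≤ℕ toℕ j → B i j ≤ B i′ j)

  Robinsonian : {n : ℕ} → Matrix n → Set ℓ₂
  Robinsonian {n} B = Σ (Permutation′ n) λ π → Robinson (λ i j → B (π ⟨$⟩ʳ i) (π ⟨$⟩ʳ j))

  IsCompletion : {n : ℕ} → IMatrix n → Matrix n → Set (c ⊔ ℓ₁)
  IsCompletion {n} A B = Symmetric B × ((i j : Fin n) (x : V) → A i j ≡ just x → B i j ≈ x)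

  IsCompletionIn : ∀ {s} {n : ℕ} → (V → Set s) → IMatrix n → Matrix n → Set (c ⊔ ℓ₁ ⊔ s)
  IsCompletionIn {n = n} S A B = IsCompletion A B × ((i j : Fin n) → A i j ≡ nothing → S (B i j))

  HasRobinsonianCompletion : {n : ℕ} → IMatrix n → Set (c ⊔ ℓ₁ ⊔ ℓ₂)
  HasRobinsonianCompletion {n} A = Σ (Matrix n) λ B → IsCompletion A B × Robinsonian B

  HasRobinsonianCompletionIn : ∀ {s} {n : ℕ} → (V → Set s) → IMatrix n → Set (c ⊔ ℓ₁ ⊔ ℓ₂ ⊔ s)
  HasRobinsonianCompletionIn {n = n} S A = Σ (Matrix n) λ B → IsCompletionIn S A B × Robinsonian B

-- Reorder indices so that a given Robinsonian completion R is Robinson.  In a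
-- Robinson matrix each entry R i j is a lower bound for the whole square block of
-- indices between i and j.  Now give entry (i, j) the least known entry of A in
-- that block, or the largest known entry of A if the block has none.  Shrinking
-- the block can only raise this minimum, so the new matrix is again Robinson; its
-- values lie in w(A); and at a known entry of A the minimum is that entry itself,
-- because R, which agrees with A there, dominates it on the block.

module Submission where

open import Defs
open import Level using (Level; 0ℓ)
open import Data.Nat using (ℕ; zero; suc; _+_; _∸_; _⊓_; _⊔_; z≤n; s≤s)
  renaming (_≤_ to _≤ℕ_; _<_ to _<ℕ_; _≤?_ to _≤ℕ?_)
open import Data.Nat.Properties
  using (≤-refl; ≤-trans; ≤-<-trans; ≤-total; <⇒≤; n≤1+n; m≤n+m; +-suc; m∸n+n≡m;
         ⊓-comm; ⊔-comm; m≤n⇒m⊓n≡m; m≤n⇒m⊔n≡n; m≥n⇒m⊓n≡n; m≥n⇒m⊔n≡m;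
         m⊓n≤m; m⊓n≤n; m≤m⊔n; m≤n⊔m)
open import Data.Fin using (Fin; toℕ; fromℕ<)
open import Data.Fin.Properties using (toℕ-injective; toℕ-fromℕ<; toℕ<n)
open import Data.Fin.Permutation using (Permutation′; _⟨$⟩ʳ_; _⟨$⟩ˡ_; inverseˡ; inverseʳ)
open import Data.List using (List; fromMaybe; concatMap; filter; cartesianProduct; allFin)
open import Data.List.Membership.Propositional using (_∈_; lose; find)
open import Data.List.Membership.Propositional.Properties
  using (∈-concatMap⁺; ∈-concatMap⁻; ∈-filter⁺; ∈-filter⁻; ∈-cartesianProduct⁺; ∈-allFin)
open import Data.List.Relation.Unary.All as All using (All)
open import Data.List.Relation.Unary.Any using (here; there)
open import Data.Maybe using (Maybe; just)
open import Data.Product using (Σ; ∃₂; _×_; _,_; proj₁; proj₂; uncurry)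
open import Data.Sum using (inj₁; inj₂)
open import Function using (_∘_)
open import Function.Bundles using (_⇔_; mk⇔)
open import Relation.Binary.Bundles using (TotalOrder)
open import Relation.Binary.Definitions using (Reflexive; Transitive)
open import Relation.Binary.Core using (Rel)
open import Relation.Binary.PropositionalEquality
  using (_≡_; refl; sym; cong₂; subst; subst₂)
open import Relation.Nullary.Decidable using (_×-dec_)
open import Relation.Unary using (Pred; Decidable)

∈-fromMaybe⁻ : ∀ {a} {A : Set a} {x : A} {m : Maybe A} → x ∈ fromMaybe m → m ≡ just x
∈-fromMaybe⁻ {m = just _} (here refl) = refl
∈-fromMaybe⁻ {m = just _} (there ())

module _ {r} {n : ℕ} (_∼_ : Rel (Fin n) r) (∼-refl : Reflexive _∼_) (∼-trans : Transitive _∼_)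
         (lo hi : ℕ)
         (step : ∀ a b → toℕ b ≡ suc (toℕ a) → lo ≤ℕ toℕ a → toℕ b ≤ℕ hi → a ∼ b)
         where

  steps⇒∼-gap : ∀ d {a b} → toℕ b ≡ d + toℕ a → lo ≤ℕ toℕ a → toℕ b ≤ℕ hi → a ∼ b
  steps⇒∼-gap zero b≡a _ _ rewrite toℕ-injective b≡a = ∼-refl
  steps⇒∼-gap (suc d) {a} {b} b≡d+1+a lo≤a b≤hi =
    ∼-trans (step a a′ a′≡1+a lo≤a (≤-trans a′≤b b≤hi))
            (steps⇒∼-gap d b≡d+a′ (≤-trans lo≤a (<⇒≤ a<a′)) b≤hi)
    where
      a<b : toℕ a <ℕ toℕ b
      a<b = subst (toℕ a <ℕ_) (sym b≡d+1+a) (s≤s (m≤n+m (toℕ a) d))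
      a′ : Fin n
      a′ = fromℕ< (≤-<-trans a<b (toℕ<n b))
      a′≡1+a : toℕ a′ ≡ suc (toℕ a)
      a′≡1+a = toℕ-fromℕ< _
      a<a′ : toℕ a <ℕ toℕ a′
      a<a′ = subst (toℕ a <ℕ_) (sym a′≡1+a) ≤-refl
      a′≤b : toℕ a′ ≤ℕ toℕ b
      a′≤b = subst (_≤ℕ toℕ b) (sym a′≡1+a) a<b
      b≡d+a′ : toℕ b ≡ d + toℕ a′
      b≡d+a′ = subst (λ m → toℕ b ≡ d + m) (sym a′≡1+a)
                 (subst (toℕ b ≡_) (sym (+-suc d (toℕ a))) b≡d+1+a)

  steps⇒∼ : ∀ {a b} → lo ≤ℕ toℕ a → toℕ a ≤ℕ toℕ b → toℕ b ≤ℕ hi → a ∼ b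
  steps⇒∼ {a} {b} lo≤a a≤b = steps⇒∼-gap (toℕ b ∸ toℕ a) (sym (m∸n+n≡m a≤b)) lo≤a

_∈[_,_] : {n : ℕ} → Fin n → ℕ → ℕ → Set
k ∈[ lo , hi ] = lo ≤ℕ toℕ k × toℕ k ≤ℕ hi

CellIn : {n : ℕ} → ℕ → ℕ → Pred (Fin n × Fin n) 0ℓ
CellIn lo hi (k , l) = k ∈[ lo , hi ] × l ∈[ lo , hi ]

cellIn? : {n : ℕ} (lo hi : ℕ) → Decidable (CellIn {n} lo hi)
cellIn? lo hi (k , l) =
  ((lo ≤ℕ? toℕ k) ×-dec (toℕ k ≤ℕ? hi)) ×-dec ((lo ≤ℕ? toℕ l) ×-dec (toℕ l ≤ℕ? hi))

allCells : (n : ℕ) → List (Fin n × Fin n)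
allCells n = cartesianProduct (allFin n) (allFin n)

cellsIn : (n lo hi : ℕ) → List (Fin n × Fin n)
cellsIn n lo hi = filter (cellIn? lo hi) (allCells n)

cellIn-widen : ∀ {n lo hi lo′ hi′} {c : Fin n × Fin n} →
  lo ≤ℕ lo′ → hi′ ≤ℕ hi → CellIn lo′ hi′ c → CellIn lo hi c
cellIn-widen lo≤lo′ hi′≤hi ((lo′≤k , k≤hi′) , (lo′≤l , l≤hi′)) =
  (≤-trans lo≤lo′ lo′≤k , ≤-trans k≤hi′ hi′≤hi) , (≤-trans lo≤lo′ lo′≤l , ≤-trans l≤hi′ hi′≤hi)

cellIn-everything : ∀ {n} (c : Fin n × Fin n) → CellIn 0 n c
cellIn-everything (k , l) = (z≤n , <⇒≤ (toℕ<n k)) , (z≤n , <⇒≤ (toℕ<n l))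

cellIn-span : ∀ {n} (i j : Fin n) → CellIn (toℕ i ⊓ toℕ j) (toℕ i ⊔ toℕ j) (i , j)
cellIn-span i j = (m⊓n≤m _ _ , m≤m⊔n _ _) , (m⊓n≤n _ _ , m≤n⊔m _ _)

module _ {c ℓ₁ ℓ₂ : Level} (O : TotalOrder c ℓ₁ ℓ₂) where
  open TotalOrder O renaming (Carrier to V; refl to refl-≤)
  open import Data.List.Extrema O
    using (min; max; min≈v⁺; min-mono-⊆; argmin-all; argmax-all; xs≤max)
  open import Relation.Binary.Reasoning.PartialOrder poset

  Robinson-resp : ∀ {n} {B C : Matrix O n} → (∀ i j → B i j ≡ C i j) → Robinson O C → Robinson O B
  Robinson-resp B≡C (rows , columns) =
    (λ i j′ j j≡1+j′ i≤j′ →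
       subst₂ _≤_ (sym (B≡C i j)) (sym (B≡C i j′)) (rows i j′ j j≡1+j′ i≤j′)) ,
    (λ i i′ j i′≡1+i i′≤j →
       subst₂ _≤_ (sym (B≡C i j)) (sym (B≡C i′ j)) (columns i i′ j i′≡1+i i′≤j))

  module _ {n : ℕ} {R : Matrix O n} (R-rob : Robinson O R) where

    Robinson-row : ∀ {i l j} → toℕ i ≤ℕ toℕ l → toℕ l ≤ℕ toℕ j → R i j ≤ R i l
    Robinson-row {i} {l} {j} i≤l l≤j =
      steps⇒∼ (λ a b → R i b ≤ R i a) refl-≤ (λ p q → trans q p) (toℕ i) (toℕ j)
        (λ a b b≡1+a i≤a _ → proj₁ R-rob i a b b≡1+a i≤a) i≤l l≤j ≤-refl

    Robinson-column : ∀ {i k j} → toℕ i ≤ℕ toℕ k → toℕ k ≤ℕ toℕ j → R i j ≤ R k j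
    Robinson-column {i} {k} {j} i≤k k≤j =
      steps⇒∼ (λ a b → R a j ≤ R b j) refl-≤ trans (toℕ i) (toℕ j)
        (λ a b b≡1+a _ b≤j → proj₂ R-rob a b j b≡1+a b≤j) ≤-refl i≤k k≤j

  module _ {n : ℕ} {R : Matrix O n} (R-sym : Symmetric O R) (R-rob : Robinson O R) where

    Robinson-inner : ∀ {i j k l} → CellIn (toℕ i) (toℕ j) (k , l) → R i j ≤ R k l
    Robinson-inner {i} {j} {k} {l} ((i≤k , k≤j) , (i≤l , l≤j)) with ≤-total (toℕ k) (toℕ l)
    ... | inj₁ k≤l = begin
      R i j ≤⟨ Robinson-column R-rob i≤k k≤j ⟩
      R k j ≤⟨ Robinson-row R-rob k≤l l≤j ⟩
      R k l ∎
    ... | inj₂ l≤k = begin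
      R i j ≤⟨ Robinson-column R-rob i≤l l≤j ⟩
      R l j ≤⟨ Robinson-row R-rob l≤k k≤j ⟩
      R l k ≈⟨ R-sym l k ⟩
      R k l ∎

    Robinson-span : ∀ {i j k l} → CellIn (toℕ i ⊓ toℕ j) (toℕ i ⊔ toℕ j) (k , l) → R i j ≤ R k l
    Robinson-span {i} {j} kl∈span with ≤-total (toℕ i) (toℕ j)
    ... | inj₁ i≤j rewrite m≤n⇒m⊓n≡m i≤j | m≤n⇒m⊔n≡n i≤j = Robinson-inner kl∈span
    ... | inj₂ j≤i rewrite m≥n⇒m⊓n≡n j≤i | m≥n⇒m⊔n≡m j≤i =
      trans (reflexive (R-sym i j)) (Robinson-inner kl∈span)

  module _ {n : ℕ} (P : IMatrix O n) where

    entriesIn : ℕ → ℕ → List V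
    entriesIn lo hi = concatMap (fromMaybe ∘ uncurry P) (cellsIn n lo hi)

    ∈-entriesIn⁺ : ∀ {lo hi k l x} → CellIn lo hi (k , l) → P k l ≡ just x → x ∈ entriesIn lo hi
    ∈-entriesIn⁺ {lo} {hi} {k} {l} {x} kl∈ Pkl≡x =
      ∈-concatMap⁺ (fromMaybe ∘ uncurry P) {xs = cellsIn n lo hi}
        (lose (∈-filter⁺ (cellIn? lo hi) (∈-cartesianProduct⁺ (∈-allFin k) (∈-allFin l)) kl∈)
              (subst (λ m → x ∈ fromMaybe m) (sym Pkl≡x) (here refl)))

    ∈-entriesIn⁻ : ∀ {lo hi x} → x ∈ entriesIn lo hi →
      ∃₂ λ k l → CellIn lo hi (k , l) × P k l ≡ just x
    ∈-entriesIn⁻ {lo} {hi} x∈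
      with find (∈-concatMap⁻ (fromMaybe ∘ uncurry P) {xs = cellsIn n lo hi} x∈)
    ... | (k , l) , kl∈ , x∈Pkl =
      k , l , proj₂ (∈-filter⁻ (cellIn? lo hi) {xs = allCells n} kl∈) , ∈-fromMaybe⁻ x∈Pkl

    entriesIn-all : ∀ {q} {Q : Pred V q} → (∀ k l x → P k l ≡ just x → Q x) →
      ∀ lo hi → All Q (entriesIn lo hi)
    entriesIn-all Q-entries lo hi = All.tabulate λ x∈ →
      let k , l , _ , Pkl≡x = ∈-entriesIn⁻ x∈ in Q-entries k l _ Pkl≡x

    maxEntry : V → V
    maxEntry x₀ = max x₀ (entriesIn 0 n)

    entry≤maxEntry : ∀ x₀ {k l x} → P k l ≡ just x → x ≤ maxEntry x₀
    entry≤maxEntry x₀ Pkl≡x =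
      All.lookup (xs≤max x₀ (entriesIn 0 n)) (∈-entriesIn⁺ (cellIn-everything _) Pkl≡x)

    windowMin : V → ℕ → ℕ → V
    windowMin t lo hi = min t (entriesIn lo hi)

    windowMin-antitone : ∀ t {lo hi lo′ hi′} → lo ≤ℕ lo′ → hi′ ≤ℕ hi →
      windowMin t lo hi ≤ windowMin t lo′ hi′
    windowMin-antitone t lo≤lo′ hi′≤hi = min-mono-⊆ refl-≤ λ x∈ →
      let _ , _ , kl∈ , Pkl≡x = ∈-entriesIn⁻ x∈ in
      ∈-entriesIn⁺ (cellIn-widen lo≤lo′ hi′≤hi kl∈) Pkl≡x

    windowMatrix : V → Matrix O n
    windowMatrix t i j = windowMin t (toℕ i ⊓ toℕ j) (toℕ i ⊔ toℕ j)

    windowMatrix-sym : ∀ t → Symmetric O (windowMatrix t)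
    windowMatrix-sym t i j =
      Eq.reflexive (cong₂ (windowMin t) (⊓-comm (toℕ i) _) (⊔-comm (toℕ i) _))

    windowMatrix-ordered : ∀ t {i j} → toℕ i ≤ℕ toℕ j →
      windowMatrix t i j ≡ windowMin t (toℕ i) (toℕ j)
    windowMatrix-ordered t i≤j = cong₂ (windowMin t) (m≤n⇒m⊓n≡m i≤j) (m≤n⇒m⊔n≡n i≤j)

    windowMatrix-robinson : ∀ t → Robinson O (windowMatrix t)
    windowMatrix-robinson t = rows , columns
      where
        rows : ∀ i j′ j → toℕ j ≡ suc (toℕ j′) → toℕ i ≤ℕ toℕ j′ →
          windowMatrix t i j ≤ windowMatrix t i j′
        rows i j′ j j≡1+j′ i≤j′ =
          subst₂ _≤_ (sym (windowMatrix-ordered t (≤-trans i≤j′ j′≤j)))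
                     (sym (windowMatrix-ordered t i≤j′))
            (windowMin-antitone t ≤-refl j′≤j)
          where
            j′≤j : toℕ j′ ≤ℕ toℕ j
            j′≤j = subst (toℕ j′ ≤ℕ_) (sym j≡1+j′) (n≤1+n _)
        columns : ∀ i i′ j → toℕ i′ ≡ suc (toℕ i) → toℕ i′ ≤ℕ toℕ j →
          windowMatrix t i j ≤ windowMatrix t i′ j
        columns i i′ j i′≡1+i i′≤j =
          subst₂ _≤_ (sym (windowMatrix-ordered t (≤-trans i≤i′ i′≤j)))
                     (sym (windowMatrix-ordered t i′≤j))
            (windowMin-antitone t i≤i′ ≤-refl)
          where
            i≤i′ : toℕ i ≤ℕ toℕ i′
            i≤i′ = subst (toℕ i ≤ℕ_) (sym i′≡1+i) (n≤1+n _)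

    windowMatrix-all : ∀ {q} {Q : Pred V q} {t} → Q t → (∀ k l x → P k l ≡ just x → Q x) →
      ∀ i j → Q (windowMatrix t i j)
    windowMatrix-all {Q = Q} Q-t Q-entries i j =
      argmin-all (λ v → v) {P = Q} Q-t (entriesIn-all Q-entries _ _)

    windowMatrix-agrees : ∀ {t} {R : Matrix O n} → Symmetric O R → Robinson O R →
      (∀ k l x → P k l ≡ just x → R k l ≈ x) → (∀ k l x → P k l ≡ just x → x ≤ t) →
      ∀ i j x → P i j ≡ just x → windowMatrix t i j ≈ x
    windowMatrix-agrees {R = R} R-sym R-rob R-agrees entries≤t i j x Pij≡x =
      min≈v⁺ (∈-entriesIn⁺ (cellIn-span i j) Pij≡x) (All.tabulate x≤entry) (entries≤t i j x Pij≡x)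
      where
        x≤entry : ∀ {y} → y ∈ entriesIn (toℕ i ⊓ toℕ j) (toℕ i ⊔ toℕ j) → x ≤ y
        x≤entry {y} y∈ with ∈-entriesIn⁻ y∈
        ... | k , l , kl∈span , Pkl≡y = begin
          x     ≈⟨ Eq.sym (R-agrees i j x Pij≡x) ⟩
          R i j ≤⟨ Robinson-span R-sym R-rob kl∈span ⟩
          R k l ≈⟨ R-agrees k l y Pkl≡y ⟩
          y     ∎

  module _ {n : ℕ} (A : IMatrix O n) where

    permutedCompletion : ∀ {q} {Q : Pred V q} (π : Permutation′ n) (C : Matrix O n) →
      Symmetric O C → Robinson O C →
      (∀ k l x → A (π ⟨$⟩ʳ k) (π ⟨$⟩ʳ l) ≡ just x → C k l ≈ x) → (∀ k l → Q (C k l)) →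
      HasRobinsonianCompletionIn O Q A
    permutedCompletion π C C-sym C-rob C-agrees Q-C =
      B , ((B-sym , B-agrees) , λ p q _ → Q-C _ _) , π , Robinson-resp B∘π≡C C-rob
      where
        B : Matrix O n
        B p q = C (π ⟨$⟩ˡ p) (π ⟨$⟩ˡ q)
        B-sym : Symmetric O B
        B-sym p q = C-sym _ _
        B-agrees : ∀ p q x → A p q ≡ just x → B p q ≈ x
        B-agrees p q x Apq≡x =
          C-agrees _ _ x
            (subst₂ (λ p′ q′ → A p′ q′ ≡ just x) (sym (inverseʳ π)) (sym (inverseʳ π)) Apq≡x)
        B∘π≡C : ∀ i j → B (π ⟨$⟩ʳ i) (π ⟨$⟩ʳ j) ≡ C i j
        B∘π≡C i j = cong₂ C (inverseˡ π) (inverseˡ π)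

    -- The default for blocks without known entries must dominate every known entry,
    -- which is why A needs at least one entry.
    completionIn-entries : ∀ {p q x₀} → A p q ≡ just x₀ →
      HasRobinsonianCompletion O A → HasRobinsonianCompletionIn O (λ v → _∈w_ O v A) A
    completionIn-entries {p} {q} {x₀} Apq≡x₀ (B , (B-sym , B-agrees) , π , R-rob) =
      permutedCompletion {Q = InW} π (windowMatrix P t)
        (windowMatrix-sym P t) (windowMatrix-robinson P t)
        (windowMatrix-agrees P (λ k l → B-sym _ _) R-rob (λ k l → B-agrees _ _)
          (λ k l x → entry≤maxEntry A x₀))
        (windowMatrix-all P {Q = InW} t-∈w (λ k l x Pkl≡x → _ , _ , x , Pkl≡x , Eq.refl))
      where
        InW : Pred V _
        InW v = _∈w_ O v A
        P : IMatrix O n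
        P k l = A (π ⟨$⟩ʳ k) (π ⟨$⟩ʳ l)
        t : V
        t = maxEntry A x₀
        t-∈w : InW t
        t-∈w = argmax-all (λ v → v) {P = InW} (p , q , x₀ , Apq≡x₀ , Eq.refl)
          (entriesIn-all A (λ k l x Akl≡x → k , l , x , Akl≡x , Eq.refl) 0 n)

lemma2 : {c ℓ₁ ℓ₂ : Level} (O : TotalOrder c ℓ₁ ℓ₂) (n : ℕ) (A : IMatrix O n) →
    ISymmetric O A →
    Σ (Fin n) (λ i → Σ (Fin n) (λ j → Σ (TotalOrder.Carrier O) (λ x → A i j ≡ just x))) →
    HasRobinsonianCompletion O A ⇔ HasRobinsonianCompletionIn O (λ v → _∈w_ O v A) A
lemma2 O n A _ (_ , _ , _ , Apq≡x₀) =
  mk⇔ (completionIn-entries O A Apq≡x₀)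
      (λ (B , (B-completes , _) , B-rob) → B , B-completes , B-rob)
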